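{- For every integer $n\ge 2$ there exists an $n$-vertex weighted undirected graph $G$ with $\mathrm{cdim}(G)=2n-3$.
   Context: A weighted undirected graph is $G=(V,w)$ where $w$ assigns a nonnegative real weight to every unordered pair of distinct vertices; its edge set is $E=\{e: w(e)>0\}$, $m=|E|$. For $\emptyset\ne X\subsetneq V$, the cut $\Delta(X)$ is the set of edges with exactly one endpoint in $X$, of weight $\sum_{e\in\Delta(X)}w(e)$. $\mathcal{M}(G)$ is the set of minimum-weight cuts, $\chi(S)\in\{0,1\}^m$ is the characteristic vector of $S\subseteq E$ among the edges, and $\mathrm{cdim}(G)=\dim\mathrm{span}\{\chi(S):S\in\mathcal{M}(G)\}$. -}

module Defs where

open import Data.Nat using (ℕ; zero; suc)
open import Data.Fin using (Fin; zero; suc; _<?_)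
import Data.Fin as F
open import Data.Bool using (Bool; true; false; if_then_else_; _∧_; _xor_)
open import Data.Rational using (ℚ; 0ℚ; 1ℚ; _+_; _*_; _≤_; _<_)
open import Data.Product using (Σ; ∃; _×_; _,_; proj₁; proj₂)
open import Relation.Nullary using (does)
open import Relation.Binary.PropositionalEquality using (_≡_)

sumFin : (k : ℕ) → (Fin k → ℚ) → ℚ
sumFin zero    f = 0ℚ
sumFin (suc k) f = f zero + sumFin k (λ i → f (suc i))

-- Weighted undirected graph on vertex set Fin n: a weight for each pair,
-- symmetric and nonnegative (diagonal entries are never used).
record WeightedGraph (n : ℕ) : Set where
  field
    w      : Fin n → Fin n → ℚ
    w-sym  : ∀ i j → w i j ≡ w j i
    w-nonneg : ∀ i j → 0ℚ ≤ w i j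
open WeightedGraph public

-- Edge set E = {{i,j} : w(i,j) > 0}, each unordered pair represented once by i < j.
Edge : ∀ {n} → WeightedGraph n → Set
Edge {n} G = Σ (Fin n × Fin n) λ p → (proj₁ p F.< proj₂ p) × (0ℚ < w G (proj₁ p) (proj₂ p))

EVec : ∀ {n} → WeightedGraph n → Set
EVec G = Edge G → ℚ

VSubset : ℕ → Set
VSubset n = Fin n → Bool

Proper : ∀ {n} → VSubset n → Set
Proper X = (∃ λ i → X i ≡ true) × (∃ λ j → X j ≡ false)

cutWeight : ∀ {n} → WeightedGraph n → VSubset n → ℚ
cutWeight {n} G X =
  sumFin n λ i → sumFin n λ j →
    if does (i <? j) ∧ (X i xor X j) then w G i j else 0ℚ

IsMinCut : ∀ {n} → WeightedGraph n → VSubset n → Set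
IsMinCut {n} G X = Proper X × (∀ (Y : VSubset n) → Proper Y → cutWeight G X ≤ cutWeight G Y)

χ : ∀ {n} (G : WeightedGraph n) → VSubset n → EVec G
χ G X ((i , j) , _) = if X i xor X j then 1ℚ else 0ℚ

MinCutVector : ∀ {n} (G : WeightedGraph n) → EVec G → Set
MinCutVector {n} G v = ∃ λ (X : VSubset n) → IsMinCut G X × (∀ e → v e ≡ χ G X e)

linComb : ∀ {n} {G : WeightedGraph n} {k : ℕ} → (Fin k → ℚ) → (Fin k → EVec G) → EVec G
linComb {k = k} c b e = sumFin k (λ i → c i * b i e)

InSpan : ∀ {n} (G : WeightedGraph n) → (EVec G → Set) → EVec G → Set
InSpan G P v = Σ ℕ λ k → Σ (Fin k → EVec G) λ u → (∀ i → P (u i)) ×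
                 Σ (Fin k → ℚ) λ c → ∀ e → v e ≡ linComb {G = G} c u e

SpannedBy : ∀ {n} (G : WeightedGraph n) {d : ℕ} → (Fin d → EVec G) → EVec G → Set
SpannedBy G {d} b v = Σ (Fin d → ℚ) λ c → ∀ e → v e ≡ linComb {G = G} c b e

LinIndep : ∀ {n} (G : WeightedGraph n) {d : ℕ} → (Fin d → EVec G) → Set
LinIndep G {d} b = ∀ (c : Fin d → ℚ) → (∀ e → linComb {G = G} c b e ≡ 0ℚ) → ∀ i → c i ≡ 0ℚ

HasSpanDim : ∀ {n} (G : WeightedGraph n) → (EVec G → Set) → ℕ → Set
HasSpanDim G P d = Σ (Fin d → EVec G) λ b →
  (∀ i → InSpan G P (b i)) × LinIndep G b × (∀ v → P v → SpannedBy G b v)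

CDim : ∀ {n} → WeightedGraph n → ℕ → Set
CDim G d = HasSpanDim G (MinCutVector G) d

module Submission where

-- The graph on the vertices 0, 1, …, n-1 is the path 0 – 1 – ⋯ – (n-1) with edges of weight
-- n-1, a fan of unit-weight edges from 0 and from n-1 to every inner vertex, and an edge of
-- weight 3 between the two ends. Its cut weight is
--   (n-1)·(path edges cut) + (inner vertices cut off 0) + (inner vertices cut off n-1) + 3·[ends cut],
-- and the minimum is 2n. If the cut separates the ends, every inner vertex is cut off exactly one
-- end and the path is cut at least once, so equality holds exactly for the n-1 prefix sets
-- {0, …, t}. Otherwise the path is cut at least twice and some inner vertex is cut off both ends,
-- so equality holds exactly for the n-2 inner singletons. The 2n-3 vectors of these cuts are
-- independent: the edge joining the ends shows that the prefix coefficients sum to 0, the two fan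
-- edges at an inner vertex then kill its singleton coefficient, and the path edges finally kill
-- the prefix coefficients one at a time.

open import Algebra.Bundles using (Semiring)
open import Data.Bool using (Bool; true; false; if_then_else_; _∧_; _xor_)
open import Data.Fin using (Fin; zero; suc; toℕ; _↑ˡ_; _↑ʳ_)
open import Data.Nat as ℕ using (ℕ; zero; suc; _≡ᵇ_)
open import Function using (_∘_)
open import Relation.Binary.PropositionalEquality.Core using (_≡_)

module IndicatorSums {c ℓ} (R : Semiring c ℓ) where

  open Semiring R hiding (zero)
  open import Algebra.Properties.Semiring.Sum R public
  open import Relation.Binary.Reasoning.Setoid setoid

  ind : Bool → Carrier
  ind b = if b then 1# else 0#

  ind-∧ : ∀ p q → ind (p ∧ q) ≈ ind p * ind q
  ind-∧ true  q = sym (*-identityˡ (ind q))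
  ind-∧ false q = sym (zeroˡ (ind q))

  ind-xor-split : ∀ a b y → a xor b ≡ true → ind (a xor y) + ind (y xor b) ≈ 1#
  ind-xor-split true  false true  _ = +-identityˡ 1#
  ind-xor-split true  false false _ = +-identityʳ 1#
  ind-xor-split false true  true  _ = +-identityʳ 1#
  ind-xor-split false true  false _ = +-identityˡ 1#

  ∑-zero : ∀ {m} (f : Fin m → Carrier) → (∀ j → f j ≈ 0#) → sum f ≈ 0#
  ∑-zero {zero}  f f≈0 = refl
  ∑-zero {suc m} f f≈0 = trans (+-cong (f≈0 zero) (∑-zero (f ∘ suc) (f≈0 ∘ suc))) (+-identityˡ 0#)

  ∑-δ : ∀ {m} (f : Fin m → Carrier) (i : Fin m) → ∑[ j < m ] (ind (toℕ i ≡ᵇ toℕ j) * f j) ≈ f i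
  ∑-δ {suc m} f zero = begin
    1# * f zero + ∑[ j < m ] (0# * f (suc j))
      ≈⟨ +-cong (*-identityˡ (f zero)) (∑-zero _ (λ j → zeroˡ (f (suc j)))) ⟩
    f zero + 0#
      ≈⟨ +-identityʳ (f zero) ⟩
    f zero ∎
  ∑-δ {suc m} f (suc i) = begin
    0# * f zero + ∑[ j < m ] (ind (toℕ i ≡ᵇ toℕ j) * f (suc j))
      ≈⟨ +-cong (zeroˡ (f zero)) (∑-δ (f ∘ suc) i) ⟩
    0# + f (suc i)
      ≈⟨ +-identityˡ (f (suc i)) ⟩
    f (suc i) ∎

  ∑-↑ˡ-↑ʳ : ∀ m {n} (f : Fin (m ℕ.+ n) → Carrier) →
            sum f ≈ ∑[ i < m ] f (i ↑ˡ n) + ∑[ j < n ] f (m ↑ʳ j)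
  ∑-↑ˡ-↑ʳ zero    f = sym (+-identityˡ (sum f))
  ∑-↑ˡ-↑ʳ (suc m) f = trans (+-congˡ (∑-↑ˡ-↑ʳ m (f ∘ suc))) (sym (+-assoc (f zero) _ _))

open import Defs
open import Algebra.Bundles using (CommutativeMonoid; Ring)
open import Data.Bool using (T; not)
open import Data.Bool.Properties
  using (∧-comm; xor-same; xor-comm; xor-identityʳ; not-involutive; not-injective; ⇔→≡)
open import Data.Empty using (⊥-elim)
open import Data.Fin using (fromℕ<; splitAt; join)
open import Data.Fin.Properties
  using (toℕ-fromℕ<; toℕ<n; splitAt-join; splitAt-↑ˡ; splitAt-↑ʳ; join-splitAt)
open import Data.Nat using (_+_; _*_; _∸_; _≤_; _<_; z≤n; s≤s; _≤?_; _<ᵇ_)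
import Data.Nat.Properties as ℕP
open import Data.Nat.Tactic.RingSolver using (solve-∀)
open import Data.Product using (Σ; ∃; _×_; _,_; proj₁; proj₂)
open import Data.Rational as ℚ using (ℚ; 0ℚ; 1ℚ)
import Data.Rational.Properties as ℚP
open import Data.Sum using (_⊎_; inj₁; inj₂)
open import Function using (mk⇔)
open import Relation.Binary using (tri<; tri≈; tri>)
open import Relation.Binary.PropositionalEquality
open import Relation.Nullary using (yes; no)

open import Algebra.Properties.CommutativeSemigroup ℕP.*-commutativeSemigroup
  using (x∙yz≈y∙xz; x∙yz≈y∙zx)
open import Algebra.Properties.CommutativeSemigroup
  (CommutativeMonoid.commutativeSemigroup ℚP.+-0-commutativeMonoid)
  using () renaming (interchange to ℚ+-interchange)
open import Algebra.Properties.Monoid.Mult ℚP.+-0-monoid as ℚMult using (×-homo-+)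

module ℕΣ = IndicatorSums ℕP.+-*-semiring
module ℚΣ = IndicatorSums (Ring.semiring ℚP.+-*-ring)
open ℕΣ using (sum; sum-syntax; ind)

toℚ : ℕ → ℚ
toℚ m = m ℚMult.× 1ℚ

toℚ-+ : ∀ m n → toℚ (m + n) ≡ toℚ m ℚ.+ toℚ n
toℚ-+ m n = ×-homo-+ 1ℚ m n

0<1 : 0ℚ ℚ.< 1ℚ
0<1 = ℚP.positive⁻¹ 1ℚ

0≤toℚ : ∀ m → 0ℚ ℚ.≤ toℚ m
0≤toℚ zero    = ℚP.≤-refl
0≤toℚ (suc m) =
  subst (ℚ._≤ toℚ (suc m)) (ℚP.+-identityˡ 0ℚ) (ℚP.+-mono-≤ (ℚP.<⇒≤ 0<1) (0≤toℚ m))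

0<toℚ : ∀ {m} → 1 ≤ m → 0ℚ ℚ.< toℚ m
0<toℚ {suc m} _ = subst (ℚ._< toℚ (suc m)) (ℚP.+-identityˡ 0ℚ) (ℚP.+-mono-<-≤ 0<1 (0≤toℚ m))

toℚ-mono-≤ : ∀ {m n} → m ≤ n → toℚ m ℚ.≤ toℚ n
toℚ-mono-≤ {n = n} z≤n = 0≤toℚ n
toℚ-mono-≤ (s≤s m≤n)   = ℚP.+-monoʳ-≤ 1ℚ (toℚ-mono-≤ m≤n)

toℚ-mono-< : ∀ {m n} → m < n → toℚ m ℚ.< toℚ n
toℚ-mono-< {n = suc n} (s≤s z≤n) = 0<toℚ {suc n} (s≤s z≤n)
toℚ-mono-< {suc m} {suc n} (s≤s m<n@(s≤s _)) = ℚP.+-monoʳ-< 1ℚ (toℚ-mono-< m<n)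

toℚ-cancel-≤ : ∀ {m n} → toℚ m ℚ.≤ toℚ n → m ≤ n
toℚ-cancel-≤ {m} {n} le with m ≤? n
... | yes m≤n = m≤n
... | no  m≰n = ⊥-elim (ℚP.<-irrefl refl (ℚP.<-≤-trans (toℚ-mono-< (ℕP.≰⇒> m≰n)) le))

sumFin-toℚ : ∀ m {f : Fin m → ℚ} (g : Fin m → ℕ) →
             (∀ i → f i ≡ toℚ (g i)) → sumFin m f ≡ toℚ (sum g)
sumFin-toℚ zero    _ _   = refl
sumFin-toℚ (suc m) g f≡g = trans (cong₂ ℚ._+_ (f≡g zero) (sumFin-toℚ m (g ∘ suc) (f≡g ∘ suc)))
                                 (sym (toℚ-+ (g zero) _))

sumFin≡sum : ∀ m (f : Fin m → ℚ) → sumFin m f ≡ ℚΣ.sum f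
sumFin≡sum zero    f = refl
sumFin≡sum (suc m) f = cong (f zero ℚ.+_) (sumFin≡sum m (f ∘ suc))

if-toℚ : ∀ b m → (if b then toℚ m else 0ℚ) ≡ toℚ (ind b * m)
if-toℚ true  m = cong toℚ (sym (ℕP.*-identityˡ m))
if-toℚ false m = refl

half-zero : ∀ q → q ℚ.+ q ≡ 0ℚ → q ≡ 0ℚ
half-zero q e with ℚP.<-cmp q 0ℚ
... | tri≈ _ q≡0 _ = q≡0
... | tri< q<0 _ _ = ⊥-elim (ℚP.<-irrefl (trans e (sym (ℚP.+-identityˡ 0ℚ))) (ℚP.+-mono-< q<0 q<0))
... | tri> _ _ q>0 = ⊥-elim (ℚP.<-irrefl (trans (ℚP.+-identityˡ 0ℚ) (sym e)) (ℚP.+-mono-< q>0 q>0))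

xor-trans : ∀ a b c → (a xor b) xor (b xor c) ≡ a xor c
xor-trans true  true  c     = refl
xor-trans true  false c     = refl
xor-trans false true  c     = not-involutive c
xor-trans false false c     = refl

xor-shift : ∀ a b c → (a xor b) ≡ false → a xor c ≡ b xor c
xor-shift a b c e = trans (sym (xor-trans a b c)) (cong (_xor (b xor c)) e)

xor-flip : ∀ a b c → (a xor b) ≡ true → a xor c ≡ not (b xor c)
xor-flip a b c e = trans (sym (xor-trans a b c)) (cong (_xor (b xor c)) e)

true≢false : true ≢ false
true≢false ()

≡ᵇ-refl : ∀ m → (m ≡ᵇ m) ≡ true
≡ᵇ-refl zero    = refl
≡ᵇ-refl (suc m) = ≡ᵇ-refl m

≡ᵇ-true⇒≡ : ∀ {m n} → (m ≡ᵇ n) ≡ true → m ≡ n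
≡ᵇ-true⇒≡ {m} {n} e = ℕP.≡ᵇ⇒≡ m n (subst T (sym e) _)

≡ᵇ-comm : ∀ m n → (m ≡ᵇ n) ≡ (n ≡ᵇ m)
≡ᵇ-comm zero    zero    = refl
≡ᵇ-comm zero    (suc n) = refl
≡ᵇ-comm (suc m) zero    = refl
≡ᵇ-comm (suc m) (suc n) = ≡ᵇ-comm m n

<⇒<ᵇ-true-false : ∀ {u v} → u < v → (u <ᵇ v) ≡ true × (v <ᵇ u) ≡ false
<⇒<ᵇ-true-false {zero}  {suc v} _         = refl , refl
<⇒<ᵇ-true-false {suc u} {suc v} (s≤s u<v) = <⇒<ᵇ-true-false u<v

<⇒≡ᵇ-false : ∀ {j m} → j < m → (m ≡ᵇ j) ≡ false
<⇒≡ᵇ-false {zero}  {suc m} _         = refl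
<⇒≡ᵇ-false {suc j} {suc m} (s≤s j<m) = <⇒≡ᵇ-false j<m

ind≡0 : ∀ b → ind b ≡ 0 → b ≡ false
ind≡0 false _ = refl

∑-pick : ∀ {m} t → t < m → (f : ℕ → ℕ) → ∑[ j < m ] (ind (t ≡ᵇ toℕ j) * f (toℕ j)) ≡ f t
∑-pick {m} t t<m f = subst (λ s → ∑[ j < m ] (ind (s ≡ᵇ toℕ j) * f (toℕ j)) ≡ f s)
                           (toℕ-fromℕ< t<m) (ℕΣ.∑-δ (f ∘ toℕ) (fromℕ< t<m))

∑-count : ∀ {m} t → t < m → ∑[ j < m ] ind (t ≡ᵇ toℕ j) ≡ 1
∑-count {m} t t<m = trans (ℕΣ.sum-cong-≗ {m} λ j → sym (ℕP.*-identityʳ (ind (t ≡ᵇ toℕ j))))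
                          (∑-pick t t<m (λ _ → 1))

∑-ones : ∀ m → ∑[ j < m ] 1 ≡ m
∑-ones zero    = refl
∑-ones (suc m) = cong suc (∑-ones m)

term≤∑ : ∀ {m t} → t < m → (f : ℕ → ℕ) → f t ≤ ∑[ i < m ] f (toℕ i)
term≤∑ {suc m} {zero}  _         f = ℕP.m≤m+n (f 0) _
term≤∑ {suc m} {suc t} (s≤s t<m) f = ℕP.≤-trans (term≤∑ t<m (f ∘ suc)) (ℕP.m≤n+m _ (f 0))

∑ind≡0⇒false : ∀ m (b : ℕ → Bool) → ∑[ i < m ] ind (b (toℕ i)) ≡ 0 → ∀ j → j < m → b j ≡ false
∑ind≡0⇒false (suc m) b e zero    _         = ind≡0 (b 0) (ℕP.m+n≡0⇒m≡0 (ind (b 0)) e)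
∑ind≡0⇒false (suc m) b e (suc j) (s≤s j<m) =
  ∑ind≡0⇒false m (b ∘ suc) (ℕP.m+n≡0⇒n≡0 (ind (b 0)) e) j j<m

∑ind≡1⇒unique : ∀ m (b : ℕ → Bool) → ∑[ i < m ] ind (b (toℕ i)) ≡ 1 →
                ∃ λ t → t < m × b t ≡ true × (∀ j → j < m → b j ≡ true → j ≡ t)
∑ind≡1⇒unique zero    b ()
∑ind≡1⇒unique (suc m) b e with b 0 in b₀
... | true  = 0 , s≤s z≤n , b₀ , only-0
  where
  only-0 : ∀ j → j < suc m → b j ≡ true → j ≡ 0
  only-0 zero    _         _  = refl
  only-0 (suc j) (s≤s j<m) bj =
    ⊥-elim (true≢false (trans (sym bj) (∑ind≡0⇒false m (b ∘ suc) (ℕP.suc-injective e) j j<m)))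
... | false with ∑ind≡1⇒unique m (b ∘ suc) e
...   | t , t<m , bt , only-t = suc t , s≤s t<m , bt , only-suc-t
  where
  only-suc-t : ∀ j → j < suc m → b j ≡ true → j ≡ suc t
  only-suc-t zero    _         b0 = ⊥-elim (true≢false (trans (sym b0) b₀))
  only-suc-t (suc j) (s≤s j<m) bj = cong suc (only-t j j<m bj)

-- Crossings of a path

crossings : ℕ → (ℕ → Bool) → ℕ
crossings m x = ∑[ i < m ] ind (x (toℕ i) xor x (suc (toℕ i)))

crossings-≥1 : ∀ m x → x 0 xor x m ≡ true → 1 ≤ crossings m x
crossings-≥1 zero    x e = ⊥-elim (true≢false (trans (sym e) (xor-same (x 0))))
crossings-≥1 (suc m) x e with x 0 xor x 1 in e₁
... | true  = s≤s z≤n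
... | false = crossings-≥1 m (x ∘ suc) (trans (sym (xor-shift (x 0) (x 1) (x (suc m)) e₁)) e)

crossings-≥2 : ∀ m x {v} → v ≤ m → x 0 xor x v ≡ true → x 0 xor x m ≡ false → 2 ≤ crossings m x
crossings-≥2 m x {zero} _ e _ = ⊥-elim (true≢false (trans (sym e) (xor-same (x 0))))
crossings-≥2 (suc m) x {suc v} (s≤s v≤m) e f with x 0 xor x 1 in e₁
... | true  = s≤s (crossings-≥1 m (x ∘ suc)
                  (not-injective (trans (sym (xor-flip (x 0) (x 1) (x (suc m)) e₁)) f)))
... | false = crossings-≥2 m (x ∘ suc) v≤m (trans (sym (xor-shift (x 0) (x 1) (x (suc v)) e₁)) e)
                                           (trans (sym (xor-shift (x 0) (x 1) (x (suc m)) e₁)) f)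

crossings≡0⇒constant : ∀ m x → crossings m x ≡ 0 → ∀ v → v ≤ m → x 0 xor x v ≡ false
crossings≡0⇒constant m       x _ zero    _         = xor-same (x 0)
crossings≡0⇒constant (suc m) x e (suc v) (s≤s v≤m) =
  trans (xor-shift (x 0) (x 1) (x (suc v)) e₁)
        (crossings≡0⇒constant m (x ∘ suc) (ℕP.m+n≡0⇒n≡0 (ind (x 0 xor x 1)) e) v v≤m)
  where
  e₁ : x 0 xor x 1 ≡ false
  e₁ = ind≡0 _ (ℕP.m+n≡0⇒m≡0 (ind (x 0 xor x 1)) e)

crossings≡1⇒threshold : ∀ m x → crossings m x ≡ 1 →
                        ∃ λ t → t < m × (∀ v → v ≤ m → x 0 xor x v ≡ (t <ᵇ v))
crossings≡1⇒threshold zero    x ()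
crossings≡1⇒threshold (suc m) x e with x 0 xor x 1 in e₁
... | true  = 0 , s≤s z≤n , above-0
  where
  above-0 : ∀ v → v ≤ suc m → x 0 xor x v ≡ (0 <ᵇ v)
  above-0 zero    _         = xor-same (x 0)
  above-0 (suc v) (s≤s v≤m) = trans (xor-flip (x 0) (x 1) (x (suc v)) e₁)
    (cong not (crossings≡0⇒constant m (x ∘ suc) (ℕP.suc-injective e) v v≤m))
... | false with crossings≡1⇒threshold m (x ∘ suc) e
...   | t , t<m , above-t = suc t , s≤s t<m , above-suc-t
  where
  above-suc-t : ∀ v → v ≤ suc m → x 0 xor x v ≡ (suc t <ᵇ v)
  above-suc-t zero    _         = xor-same (x 0)
  above-suc-t (suc v) (s≤s v≤m) = trans (xor-shift (x 0) (x 1) (x (suc v)) e₁) (above-t v v≤m)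

-- Sums over ordered pairs of vertices

edge : ℕ → ℕ → ℕ → ℕ → ℕ
edge u v a b = ind ((u ≡ᵇ a) ∧ (v ≡ᵇ b)) + ind ((v ≡ᵇ a) ∧ (u ≡ᵇ b))

module PairSums (n : ℕ) (κ : ℕ → ℕ → ℕ) where

  pairSum : (ℕ → ℕ → ℕ) → ℕ
  pairSum F = ∑[ a < n ] ∑[ b < n ] (κ (toℕ a) (toℕ b) * F (toℕ a) (toℕ b))

  pairSum-+ : ∀ F G → pairSum (λ a b → F a b + G a b) ≡ pairSum F + pairSum G
  pairSum-+ F G = begin
    ∑[ a < n ] ∑[ b < n ] (κ (toℕ a) (toℕ b) * (F (toℕ a) (toℕ b) + G (toℕ a) (toℕ b)))
      ≡⟨ ℕΣ.sum-cong-≗ {n} (λ a → ℕΣ.sum-cong-≗ {n} λ b → ℕP.*-distribˡ-+ (κ (toℕ a) (toℕ b)) _ _) ⟩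
    ∑[ a < n ] ∑[ b < n ] (κF a b + κG a b)
      ≡⟨ ℕΣ.sum-cong-≗ {n} (λ a → ℕΣ.∑-distrib-+ (κF a) (κG a)) ⟩
    ∑[ a < n ] (∑[ b < n ] κF a b + ∑[ b < n ] κG a b)
      ≡⟨ ℕΣ.∑-distrib-+ (λ a → ∑[ b < n ] κF a b) (λ a → ∑[ b < n ] κG a b) ⟩
    pairSum F + pairSum G ∎
    where
    open ≡-Reasoning
    κF κG : Fin n → Fin n → ℕ
    κF a b = κ (toℕ a) (toℕ b) * F (toℕ a) (toℕ b)
    κG a b = κ (toℕ a) (toℕ b) * G (toℕ a) (toℕ b)

  pairSum-* : ∀ c F → pairSum (λ a b → c * F a b) ≡ c * pairSum F
  pairSum-* c F = begin
    ∑[ a < n ] ∑[ b < n ] (κ (toℕ a) (toℕ b) * (c * F (toℕ a) (toℕ b)))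
      ≡⟨ ℕΣ.sum-cong-≗ {n} (λ a → ℕΣ.sum-cong-≗ {n} λ b → x∙yz≈y∙xz (κ (toℕ a) (toℕ b)) c _) ⟩
    ∑[ a < n ] ∑[ b < n ] (c * κF a b)
      ≡⟨ ℕΣ.sum-cong-≗ {n} (λ a → ℕΣ.*-distribˡ-sum c (κF a)) ⟨
    ∑[ a < n ] (c * ∑[ b < n ] κF a b)
      ≡⟨ ℕΣ.*-distribˡ-sum c (λ a → ∑[ b < n ] κF a b) ⟨
    c * pairSum F ∎
    where
    open ≡-Reasoning
    κF : Fin n → Fin n → ℕ
    κF a b = κ (toℕ a) (toℕ b) * F (toℕ a) (toℕ b)

  pairSum-∑ : ∀ {m} (F : Fin m → ℕ → ℕ → ℕ) →
              pairSum (λ a b → ∑[ i < m ] F i a b) ≡ ∑[ i < m ] pairSum (F i)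
  pairSum-∑ {m} F = begin
    ∑[ a < n ] ∑[ b < n ] (κ (toℕ a) (toℕ b) * ∑[ i < m ] F i (toℕ a) (toℕ b))
      ≡⟨ ℕΣ.sum-cong-≗ {n} (λ a → ℕΣ.sum-cong-≗ {n} λ b →
           ℕΣ.*-distribˡ-sum (κ (toℕ a) (toℕ b)) (λ i → F i (toℕ a) (toℕ b))) ⟩
    ∑[ a < n ] ∑[ b < n ] ∑[ i < m ] κF a b i
      ≡⟨ ℕΣ.sum-cong-≗ {n} (λ a → ℕΣ.∑-comm (κF a)) ⟩
    ∑[ a < n ] ∑[ i < m ] ∑[ b < n ] κF a b i
      ≡⟨ ℕΣ.∑-comm (λ a i → ∑[ b < n ] κF a b i) ⟩
    ∑[ i < m ] pairSum (F i) ∎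
    where
    open ≡-Reasoning
    κF : Fin n → Fin n → Fin m → ℕ
    κF a b i = κ (toℕ a) (toℕ b) * F i (toℕ a) (toℕ b)

  pairSum-point : ∀ {u v} → u < n → v < n → pairSum (λ a b → ind ((u ≡ᵇ a) ∧ (v ≡ᵇ b))) ≡ κ u v
  pairSum-point {u} {v} u<n v<n = begin
    ∑[ a < n ] ∑[ b < n ] (κ (toℕ a) (toℕ b) * ind ((u ≡ᵇ toℕ a) ∧ (v ≡ᵇ toℕ b)))
      ≡⟨ ℕΣ.sum-cong-≗ {n} (λ a → ℕΣ.sum-cong-≗ {n} λ b →
           trans (cong (κ (toℕ a) (toℕ b) *_) (ℕΣ.ind-∧ (u ≡ᵇ toℕ a) (v ≡ᵇ toℕ b)))
                 (x∙yz≈y∙zx (κ (toℕ a) (toℕ b)) (ind (u ≡ᵇ toℕ a)) (ind (v ≡ᵇ toℕ b)))) ⟩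
    ∑[ a < n ] ∑[ b < n ] (ind (u ≡ᵇ toℕ a) * (ind (v ≡ᵇ toℕ b) * κ (toℕ a) (toℕ b)))
      ≡⟨ ℕΣ.sum-cong-≗ {n} (λ a →
           ℕΣ.*-distribˡ-sum {n} (ind (u ≡ᵇ toℕ a)) λ b → ind (v ≡ᵇ toℕ b) * κ (toℕ a) (toℕ b)) ⟨
    ∑[ a < n ] (ind (u ≡ᵇ toℕ a) * ∑[ b < n ] (ind (v ≡ᵇ toℕ b) * κ (toℕ a) (toℕ b)))
      ≡⟨ ℕΣ.sum-cong-≗ {n} (λ a → cong (ind (u ≡ᵇ toℕ a) *_) (∑-pick v v<n (κ (toℕ a)))) ⟩
    ∑[ a < n ] (ind (u ≡ᵇ toℕ a) * κ (toℕ a) v)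
      ≡⟨ ∑-pick u u<n (λ a → κ a v) ⟩
    κ u v ∎
    where open ≡-Reasoning

  pairSum-edge : ∀ {u v} → u < n → v < n → pairSum (edge u v) ≡ κ u v + κ v u
  pairSum-edge {u} {v} u<n v<n =
    trans (pairSum-+ (λ a b → ind ((u ≡ᵇ a) ∧ (v ≡ᵇ b))) (λ a b → ind ((v ≡ᵇ a) ∧ (u ≡ᵇ b))))
          (cong₂ _+_ (pairSum-point u<n v<n) (pairSum-point v<n u<n))

crosses : (ℕ → Bool) → ℕ → ℕ → Bool
crosses x a b = (a <ᵇ b) ∧ (x a xor x b)

module CutSums (n : ℕ) (x : ℕ → Bool) where

  open PairSums n (λ a b → ind (crosses x a b)) public

  pairSum-edge-crossing : ∀ {u v} → u < v → v < n → pairSum (edge u v) ≡ ind (x u xor x v)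
  pairSum-edge-crossing {u} {v} u<v v<n = begin
    pairSum (edge u v)
      ≡⟨ pairSum-edge (ℕP.<-trans u<v v<n) v<n ⟩
    ind ((u <ᵇ v) ∧ (x u xor x v)) + ind ((v <ᵇ u) ∧ (x v xor x u))
      ≡⟨ cong₂ (λ p q → ind (p ∧ (x u xor x v)) + ind (q ∧ (x v xor x u))) u<ᵇv v<ᵇu ⟩
    ind (x u xor x v) + 0
      ≡⟨ ℕP.+-identityʳ _ ⟩
    ind (x u xor x v) ∎
    where
    open ≡-Reasoning
    u<ᵇv = proj₁ (<⇒<ᵇ-true-false u<v)
    v<ᵇu = proj₂ (<⇒<ᵇ-true-false u<v)

-- The weighted graph and its minimum cuts

tight-+ : ∀ {a b p q} → a ≤ p → b ≤ q → p + q ≤ a + b → p ≡ a × q ≡ b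
tight-+ {a} {b} {p} {q} a≤p b≤q p+q≤a+b =
  ℕP.≤-antisym (ℕP.+-cancelʳ-≤ q p a (ℕP.≤-trans p+q≤a+b (ℕP.+-monoʳ-≤ a b≤q))) a≤p ,
  ℕP.≤-antisym (ℕP.+-cancelˡ-≤ p q b (ℕP.≤-trans p+q≤a+b (ℕP.+-monoˡ-≤ b a≤p))) b≤q

above-step : ∀ t a → (t <ᵇ a) xor (t <ᵇ suc a) ≡ (t ≡ᵇ a)
above-step zero    zero    = refl
above-step zero    (suc a) = refl
above-step (suc t) zero    = refl
above-step (suc t) (suc a) = above-step t a

only-step : ∀ a j → ind ((a ≡ᵇ suc j) xor (a ≡ᵇ j)) ≡ ind (j ≡ᵇ a) + ind (suc j ≡ᵇ a)
only-step zero    zero    = refl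
only-step zero    (suc j) = refl
only-step (suc a) zero    = cong ind (trans (xor-identityʳ (a ≡ᵇ 0)) (≡ᵇ-comm a 0))
only-step (suc a) (suc j) = only-step a j

module FannedPath (k : ℕ) where

  n L c : ℕ
  n = suc (suc k)
  L = suc k
  c = suc k

  pathEdges fan₀ fanL : ℕ → ℕ → ℕ
  pathEdges a b = ∑[ i < suc k ] edge (toℕ i) (suc (toℕ i)) a b
  fan₀      a b = ∑[ j < k ] edge 0 (suc (toℕ j)) a b
  fanL      a b = ∑[ j < k ] edge (suc (toℕ j)) L a b

  weight : ℕ → ℕ → ℕ
  weight a b = c * pathEdges a b + fan₀ a b + fanL a b + 3 * edge 0 L a b

  fan₀-crossings fanL-crossings : (ℕ → Bool) → ℕ
  fan₀-crossings x = ∑[ j < k ] ind (x 0 xor x (suc (toℕ j)))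
  fanL-crossings x = ∑[ j < k ] ind (x (suc (toℕ j)) xor x L)

  edge-sym : ∀ u v a b → edge u v a b ≡ edge u v b a
  edge-sym u v a b = trans (ℕP.+-comm (ind ((u ≡ᵇ a) ∧ (v ≡ᵇ b))) _)
                           (cong₂ _+_ (cong ind (∧-comm (v ≡ᵇ a) (u ≡ᵇ b))) (cong ind (∧-comm (u ≡ᵇ a) (v ≡ᵇ b))))

  weight-sym : ∀ a b → weight a b ≡ weight b a
  weight-sym a b = cong₂ _+_ (cong₂ _+_ (cong₂ _+_
    (cong (c *_) (ℕΣ.sum-cong-≗ {suc k} λ i → edge-sym (toℕ i) (suc (toℕ i)) a b))
    (ℕΣ.sum-cong-≗ {k} λ j → edge-sym 0 (suc (toℕ j)) a b))
    (ℕΣ.sum-cong-≗ {k} λ j → edge-sym (suc (toℕ j)) L a b))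
    (cong (3 *_) (edge-sym 0 L a b))

  edge-self : ∀ u v → 1 ≤ edge u v u v
  edge-self u v =
    ℕP.≤-trans (ℕP.≤-reflexive (cong₂ (λ p q → ind (p ∧ q)) (sym (≡ᵇ-refl u)) (sym (≡ᵇ-refl v))))
               (ℕP.m≤m+n _ _)

  weight-path : ∀ {a} → a < suc k → 1 ≤ weight a (suc a)
  weight-path {a} a<sk =
    ℕP.≤-trans (ℕP.≤-trans (edge-self a (suc a)) (term≤∑ a<sk (λ i → edge i (suc i) a (suc a))))
    (ℕP.≤-trans (ℕP.m≤m+n _ (k * pathEdges a (suc a)))
      (ℕP.≤-trans (ℕP.m≤m+n _ _) (ℕP.≤-trans (ℕP.m≤m+n _ _) (ℕP.m≤m+n _ _))))

  weight-fan₀ : ∀ {j} → j < k → 1 ≤ weight 0 (suc j)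
  weight-fan₀ {j} j<k =
    ℕP.≤-trans (ℕP.≤-trans (edge-self 0 (suc j)) (term≤∑ j<k (λ i → edge 0 (suc i) 0 (suc j))))
    (ℕP.≤-trans (ℕP.m≤n+m _ (c * pathEdges 0 (suc j))) (ℕP.≤-trans (ℕP.m≤m+n _ _) (ℕP.m≤m+n _ _)))

  weight-fanL : ∀ {j} → j < k → 1 ≤ weight (suc j) L
  weight-fanL {j} j<k =
    ℕP.≤-trans (ℕP.≤-trans (edge-self (suc j) L) (term≤∑ j<k (λ i → edge (suc i) L (suc j) L)))
    (ℕP.≤-trans (ℕP.m≤n+m _ (c * pathEdges (suc j) L + fan₀ (suc j) L)) (ℕP.m≤m+n _ _))

  weight-ends : 1 ≤ weight 0 L
  weight-ends = ℕP.≤-trans (ℕP.≤-trans (edge-self 0 L) (ℕP.m≤m+n (edge 0 L 0 L) _))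
                           (ℕP.m≤n+m (3 * edge 0 L 0 L) (c * pathEdges 0 L + fan₀ 0 L + fanL 0 L))

  cutValue : (ℕ → Bool) → ℕ
  cutValue x = CutSums.pairSum n x weight

  cutValue-formula : ∀ x → cutValue x ≡ c * crossings (suc k) x + fan₀-crossings x + fanL-crossings x
                                         + 3 * ind (x 0 xor x L)
  cutValue-formula x = begin
    pairSum weight
      ≡⟨ pairSum-+ (λ a b → c * pathEdges a b + fan₀ a b + fanL a b) (λ a b → 3 * edge 0 L a b) ⟩
    pairSum (λ a b → c * pathEdges a b + fan₀ a b + fanL a b) + pairSum (λ a b → 3 * edge 0 L a b)
      ≡⟨ cong₂ _+_ (trans (pairSum-+ (λ a b → c * pathEdges a b + fan₀ a b) fanL)
                          (cong (_+ pairSum fanL) (pairSum-+ (λ a b → c * pathEdges a b) fan₀)))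
                   (pairSum-* 3 (edge 0 L)) ⟩
    pairSum (λ a b → c * pathEdges a b) + pairSum fan₀ + pairSum fanL + 3 * pairSum (edge 0 L)
      ≡⟨ cong (λ p → p + pairSum fan₀ + pairSum fanL + 3 * pairSum (edge 0 L)) (pairSum-* c pathEdges) ⟩
    c * pairSum pathEdges + pairSum fan₀ + pairSum fanL + 3 * pairSum (edge 0 L)
      ≡⟨ cong₂ (λ p q → c * p + q + pairSum fanL + 3 * pairSum (edge 0 L))
               (pairSum-∑ {suc k} (λ i → edge (toℕ i) (suc (toℕ i))))
               (pairSum-∑ {k} (λ j → edge 0 (suc (toℕ j)))) ⟩
    c * ∑[ i < suc k ] pairSum (edge (toℕ i) (suc (toℕ i))) + ∑[ j < k ] pairSum (edge 0 (suc (toℕ j)))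
      + pairSum fanL + 3 * pairSum (edge 0 L)
      ≡⟨ cong₂ (λ p q → c * p + q + pairSum fanL + 3 * pairSum (edge 0 L))
               (ℕΣ.sum-cong-≗ {suc k} λ i → pairSum-edge-crossing ℕP.≤-refl (s≤s (toℕ<n i)))
               (ℕΣ.sum-cong-≗ {k} λ j →
                  pairSum-edge-crossing (s≤s z≤n) (s≤s (ℕP.m<n⇒m<1+n (toℕ<n j)))) ⟩
    c * crossings (suc k) x + fan₀-crossings x + pairSum fanL + 3 * pairSum (edge 0 L)
      ≡⟨ cong₂ (λ p q → c * crossings (suc k) x + fan₀-crossings x + p + 3 * q)
               (trans (pairSum-∑ {k} (λ j → edge (suc (toℕ j)) L))
                      (ℕΣ.sum-cong-≗ {k} λ j → pairSum-edge-crossing (s≤s (toℕ<n j)) ℕP.≤-refl))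
               (pairSum-edge-crossing (s≤s z≤n) ℕP.≤-refl) ⟩
    c * crossings (suc k) x + fan₀-crossings x + fanL-crossings x + 3 * ind (x 0 xor x L) ∎
    where
    open ≡-Reasoning
    open CutSums n x

  -- 2n in the form reached by the singletons; minCut≡ is the form reached by the prefix sets.
  minCut : ℕ
  minCut = c * 2 + 2 * 1

  minCut≡ : minCut ≡ c * 1 + (k + 3)
  minCut≡ = identity k
    where
    identity : ∀ k → suc k * 2 + 2 * 1 ≡ suc k * 1 + (k + 3)
    identity = solve-∀

  Nontrivial : (ℕ → Bool) → Set
  Nontrivial x = ∃ λ v → v < n × x 0 xor x v ≡ true

  fans-separating : ∀ x → x 0 xor x L ≡ true → fan₀-crossings x + fanL-crossings x ≡ k
  fans-separating x e = begin
    fan₀-crossings x + fanL-crossings x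
      ≡⟨ ℕΣ.∑-distrib-+ {k} (λ j → ind (x 0 xor x (suc (toℕ j))))
                            (λ j → ind (x (suc (toℕ j)) xor x L)) ⟨
    ∑[ j < k ] (ind (x 0 xor x (suc (toℕ j))) + ind (x (suc (toℕ j)) xor x L))
      ≡⟨ ℕΣ.sum-cong-≗ {k} (λ j → ℕΣ.ind-xor-split (x 0) (x L) (x (suc (toℕ j))) e) ⟩
    ∑[ j < k ] 1
      ≡⟨ ∑-ones k ⟩
    k ∎
    where open ≡-Reasoning

  fans-nonseparating : ∀ x → x 0 xor x L ≡ false → fanL-crossings x ≡ fan₀-crossings x
  fans-nonseparating x e = ℕΣ.sum-cong-≗ {k} λ j →
    cong ind (trans (xor-comm (x (suc (toℕ j))) (x L)) (xor-shift (x L) (x 0) _ (trans (xor-comm (x L) (x 0)) e)))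

  cutValue-separating : ∀ x → x 0 xor x L ≡ true → cutValue x ≡ c * crossings (suc k) x + (k + 3)
  cutValue-separating x e = begin
    cutValue x
      ≡⟨ cutValue-formula x ⟩
    c * crossings (suc k) x + fan₀-crossings x + fanL-crossings x + 3 * ind (x 0 xor x L)
      ≡⟨ cong (λ b → c * crossings (suc k) x + fan₀-crossings x + fanL-crossings x + 3 * ind b) e ⟩
    c * crossings (suc k) x + fan₀-crossings x + fanL-crossings x + 3
      ≡⟨ cong (_+ 3) (ℕP.+-assoc (c * crossings (suc k) x) _ _) ⟩
    c * crossings (suc k) x + (fan₀-crossings x + fanL-crossings x) + 3
      ≡⟨ ℕP.+-assoc (c * crossings (suc k) x) _ 3 ⟩
    c * crossings (suc k) x + (fan₀-crossings x + fanL-crossings x + 3)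
      ≡⟨ cong (λ f → c * crossings (suc k) x + (f + 3)) (fans-separating x e) ⟩
    c * crossings (suc k) x + (k + 3) ∎
    where open ≡-Reasoning

  cutValue-nonseparating : ∀ x → x 0 xor x L ≡ false →
                           cutValue x ≡ c * crossings (suc k) x + 2 * fan₀-crossings x
  cutValue-nonseparating x e = begin
    cutValue x
      ≡⟨ cutValue-formula x ⟩
    c * crossings (suc k) x + fan₀-crossings x + fanL-crossings x + 3 * ind (x 0 xor x L)
      ≡⟨ cong₂ (λ f b → c * crossings (suc k) x + fan₀-crossings x + f + 3 * ind b) (fans-nonseparating x e) e ⟩
    c * crossings (suc k) x + fan₀-crossings x + fan₀-crossings x + 0
      ≡⟨ double (c * crossings (suc k) x) (fan₀-crossings x) ⟩
    c * crossings (suc k) x + 2 * fan₀-crossings x ∎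
    where
    open ≡-Reasoning
    double : ∀ a b → a + b + b + 0 ≡ a + 2 * b
    double = solve-∀

  fan₀-≥1 : ∀ x → x 0 xor x L ≡ false → Nontrivial x → 1 ≤ fan₀-crossings x
  fan₀-≥1 x e (zero , _ , e₀) = ⊥-elim (true≢false (trans (sym e₀) (xor-same (x 0))))
  fan₀-≥1 x e (suc j , s≤s (s≤s j≤k) , e₀) with ℕP.m≤n⇒m<n∨m≡n j≤k
  ... | inj₁ j<k  = ℕP.≤-trans (ℕP.≤-reflexive (cong ind (sym e₀)))
                               (term≤∑ j<k (λ i → ind (x 0 xor x (suc i))))
  ... | inj₂ refl = ⊥-elim (true≢false (trans (sym e₀) e))

  minCut≤cutValue : ∀ x → Nontrivial x → minCut ≤ cutValue x
  minCut≤cutValue x nt@(v , v<n , e₀) with x 0 xor x L in e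
  ... | true  = subst₂ _≤_ (sym minCut≡) (sym (cutValue-separating x e))
                  (ℕP.+-monoˡ-≤ (k + 3) (ℕP.*-monoʳ-≤ c (crossings-≥1 (suc k) x e)))
  ... | false = subst (minCut ≤_) (sym (cutValue-nonseparating x e))
                  (ℕP.+-mono-≤ (ℕP.*-monoʳ-≤ c (crossings-≥2 (suc k) x (ℕP.≤-pred v<n) e₀ e))
                               (ℕP.*-monoʳ-≤ 2 (fan₀-≥1 x e nt)))

  -- The minimum cuts, each given by its side avoiding vertex 0: the complement of a prefix
  -- {0, …, t} and an inner singleton {j+1}.
  above only : ℕ → ℕ → Bool
  above t v = t <ᵇ v
  only j v = v ≡ᵇ suc j

  minCutSet : Fin (suc k) ⊎ Fin k → ℕ → Bool
  minCutSet (inj₁ t) = above (toℕ t)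
  minCutSet (inj₂ j) = only (toℕ j)

  SameCut : (ℕ → Bool) → (ℕ → Bool) → Set
  SameCut x y = ∀ v → v < n → x 0 xor x v ≡ y v

  crossings≡1⇒above : ∀ x → crossings (suc k) x ≡ 1 → ∃ λ s → SameCut x (minCutSet s)
  crossings≡1⇒above x e with crossings≡1⇒threshold (suc k) x e
  ... | t , t<n , above-t = inj₁ (fromℕ< t<n) , λ v v<n →
    trans (above-t v (ℕP.≤-pred v<n)) (cong (_<ᵇ v) (sym (toℕ-fromℕ< t<n)))

  fan₀≡1⇒only : ∀ x → x 0 xor x L ≡ false → fan₀-crossings x ≡ 1 → ∃ λ s → SameCut x (minCutSet s)
  fan₀≡1⇒only x e f with ∑ind≡1⇒unique k (λ i → x 0 xor x (suc i)) f
  ... | j , j<k , x₀≠xⱼ , unique = inj₂ (fromℕ< j<k) , λ v v<n →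
    trans (same v v<n) (cong (λ i → v ≡ᵇ suc i) (sym (toℕ-fromℕ< j<k)))
    where
    same : SameCut x (only j)
    same zero    _          = xor-same (x 0)
    same (suc v) (s≤s v<sk) = ⇔→≡ (mk⇔ to from)
      where
      to : x 0 xor x (suc v) ≡ true → (v ≡ᵇ j) ≡ true
      to h with ℕP.m≤n⇒m<n∨m≡n (ℕP.≤-pred v<sk)
      ... | inj₁ v<k  = subst (λ i → (v ≡ᵇ i) ≡ true) (unique v v<k h) (≡ᵇ-refl v)
      ... | inj₂ refl = ⊥-elim (true≢false (trans (sym h) e))
      from : (v ≡ᵇ j) ≡ true → x 0 xor x (suc v) ≡ true
      from h = subst (λ i → x 0 xor x (suc i) ≡ true) (sym (≡ᵇ-true⇒≡ h)) x₀≠xⱼ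

  cutValue≤minCut⇒minCutSet : ∀ x → Nontrivial x → cutValue x ≤ minCut →
                              ∃ λ s → SameCut x (minCutSet s)
  cutValue≤minCut⇒minCutSet x nt@(v , v<n , e₀) le with x 0 xor x L in e
  ... | true  = crossings≡1⇒above x (ℕP.*-cancelˡ-≡ _ _ c (proj₁ (tight-+
                  (ℕP.*-monoʳ-≤ c (crossings-≥1 (suc k) x e)) ℕP.≤-refl
                  (subst₂ _≤_ (cutValue-separating x e) minCut≡ le))))
  ... | false = fan₀≡1⇒only x e (ℕP.*-cancelˡ-≡ _ _ 2 (proj₂ (tight-+
                  (ℕP.*-monoʳ-≤ c (crossings-≥2 (suc k) x (ℕP.≤-pred v<n) e₀ e))
                  (ℕP.*-monoʳ-≤ 2 (fan₀-≥1 x e nt))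
                  (subst (_≤ minCut) (cutValue-nonseparating x e) le))))

  crossings-above : ∀ {t} → t < suc k → crossings (suc k) (above t) ≡ 1
  crossings-above {t} t<sk =
    trans (ℕΣ.sum-cong-≗ {suc k} λ a → cong ind (above-step t (toℕ a))) (∑-count t t<sk)

  crossings-only : ∀ {j} → j < k → crossings (suc k) (only j) ≡ 2
  crossings-only {j} j<k = begin
    ∑[ a < suc k ] ind ((toℕ a ≡ᵇ suc j) xor (toℕ a ≡ᵇ j))
      ≡⟨ ℕΣ.sum-cong-≗ {suc k} (λ a → only-step (toℕ a) j) ⟩
    ∑[ a < suc k ] (ind (j ≡ᵇ toℕ a) + ind (suc j ≡ᵇ toℕ a))
      ≡⟨ ℕΣ.∑-distrib-+ {suc k} (λ a → ind (j ≡ᵇ toℕ a)) (λ a → ind (suc j ≡ᵇ toℕ a)) ⟩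
    ∑[ a < suc k ] ind (j ≡ᵇ toℕ a) + ∑[ a < suc k ] ind (suc j ≡ᵇ toℕ a)
      ≡⟨ cong₂ _+_ (∑-count j (ℕP.m<n⇒m<1+n j<k)) (∑-count (suc j) (s≤s j<k)) ⟩
    2 ∎
    where open ≡-Reasoning

  fan₀-only : ∀ {j} → j < k → fan₀-crossings (only j) ≡ 1
  fan₀-only {j} j<k = trans (ℕΣ.sum-cong-≗ {k} λ i → cong ind (≡ᵇ-comm (toℕ i) j)) (∑-count j j<k)

  cutValue-minCutSet : ∀ s → cutValue (minCutSet s) ≡ minCut
  cutValue-minCutSet (inj₁ t) = begin
    cutValue (above (toℕ t))
      ≡⟨ cutValue-separating (above (toℕ t)) (proj₁ (<⇒<ᵇ-true-false (toℕ<n t))) ⟩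
    c * crossings (suc k) (above (toℕ t)) + (k + 3)
      ≡⟨ cong (λ p → c * p + (k + 3)) (crossings-above (toℕ<n t)) ⟩
    c * 1 + (k + 3)
      ≡⟨ minCut≡ ⟨
    minCut ∎
    where open ≡-Reasoning
  cutValue-minCutSet (inj₂ j) = begin
    cutValue (only (toℕ j))
      ≡⟨ cutValue-nonseparating (only (toℕ j)) (<⇒≡ᵇ-false (toℕ<n j)) ⟩
    c * crossings (suc k) (only (toℕ j)) + 2 * fan₀-crossings (only (toℕ j))
      ≡⟨ cong₂ (λ p q → c * p + 2 * q) (crossings-only (toℕ<n j)) (fan₀-only (toℕ<n j)) ⟩
    minCut ∎
    where open ≡-Reasoning

extend : ∀ {m} → (Fin m → Bool) → ℕ → Bool
extend {zero}  X _       = false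
extend {suc m} X zero    = X zero
extend {suc m} X (suc a) = extend (X ∘ suc) a

extend-toℕ : ∀ {m} (X : Fin m → Bool) i → X i ≡ extend X (toℕ i)
extend-toℕ X zero    = refl
extend-toℕ X (suc i) = extend-toℕ (X ∘ suc) i

module CutVectors (k : ℕ) where

  open FannedPath k

  graph : WeightedGraph n
  graph = record
    { w        = λ i j → toℚ (weight (toℕ i) (toℕ j))
    ; w-sym    = λ i j → cong toℚ (weight-sym (toℕ i) (toℕ j))
    ; w-nonneg = λ i j → 0≤toℚ (weight (toℕ i) (toℕ j))
    }

  cutWeight≡cutValue : ∀ X x → (∀ i → X i ≡ x (toℕ i)) → cutWeight graph X ≡ toℚ (cutValue x)
  cutWeight≡cutValue X x X≗x =
    sumFin-toℚ n (λ a → ∑[ b < n ] (ind (crosses x (toℕ a) (toℕ b)) * weight (toℕ a) (toℕ b))) λ i →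
    sumFin-toℚ n (λ b → ind (crosses x (toℕ i) (toℕ b)) * weight (toℕ i) (toℕ b)) λ j →
    trans (cong₂ (λ a b → if (toℕ i <ᵇ toℕ j) ∧ (a xor b) then w graph i j else 0ℚ) (X≗x i) (X≗x j))
          (if-toℚ (crosses x (toℕ i) (toℕ j)) (weight (toℕ i) (toℕ j)))

  proper⇒nontrivial : ∀ X → Proper X → Nontrivial (extend X)
  proper⇒nontrivial X ((i , Xi) , (j , Xj)) with X zero
  ... | true  = toℕ j , toℕ<n j , subst (λ b → true xor b ≡ true) (extend-toℕ X j) (cong not Xj)
  ... | false = toℕ i , toℕ<n i , subst (λ b → false xor b ≡ true) (extend-toℕ X i) Xi

  member⇒proper : ∀ x {v} → x 0 ≡ false → v < n → x v ≡ true → Proper {n} (x ∘ toℕ)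
  member⇒proper x x₀ v<n xᵥ = (fromℕ< v<n , trans (cong x (toℕ-fromℕ< v<n)) xᵥ) , (zero , x₀)

  minCutSet-proper : ∀ s → Proper {n} (minCutSet s ∘ toℕ)
  minCutSet-proper (inj₁ t) =
    member⇒proper (minCutSet (inj₁ t)) refl ℕP.≤-refl (proj₁ (<⇒<ᵇ-true-false (toℕ<n t)))
  minCutSet-proper (inj₂ j) =
    member⇒proper (minCutSet (inj₂ j)) refl (s≤s (ℕP.m<n⇒m<1+n (toℕ<n j))) (≡ᵇ-refl (toℕ j))

  cutWeight-extend : ∀ X → cutWeight graph X ≡ toℚ (cutValue (extend X))
  cutWeight-extend X = cutWeight≡cutValue X (extend X) (extend-toℕ X)

  cutWeight-minCutSet : ∀ s → cutWeight graph (minCutSet s ∘ toℕ) ≡ toℚ minCut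
  cutWeight-minCutSet s = trans (cutWeight≡cutValue (minCutSet s ∘ toℕ) (minCutSet s) (λ _ → refl))
                                (cong toℚ (cutValue-minCutSet s))

  minCutSet-isMinCut : ∀ s → IsMinCut graph (minCutSet s ∘ toℕ)
  minCutSet-isMinCut s = minCutSet-proper s , λ Y proper-Y →
    subst₂ ℚ._≤_ (sym (cutWeight-minCutSet s)) (sym (cutWeight-extend Y))
      (toℚ-mono-≤ (minCut≤cutValue (extend Y) (proper⇒nontrivial Y proper-Y)))

  isMinCut⇒minCutSet : ∀ X → IsMinCut graph X → ∃ λ s → SameCut (extend X) (minCutSet s)
  isMinCut⇒minCutSet X (proper-X , minimal) =
    cutValue≤minCut⇒minCutSet (extend X) (proper⇒nontrivial X proper-X)
      (toℚ-cancel-≤ (subst₂ ℚ._≤_ (cutWeight-extend X) (cutWeight-minCutSet s₀)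
                                  (minimal (minCutSet s₀ ∘ toℕ) (minCutSet-proper s₀))))
    where s₀ = inj₁ zero

  cutVector : Fin (suc k) ⊎ Fin k → EVec graph
  cutVector s = χ graph (minCutSet s ∘ toℕ)

  basis : Fin (suc k + k) → EVec graph
  basis u = cutVector (splitAt (suc k) u)

  basis-inSpan : ∀ u → InSpan graph (MinCutVector graph) (basis u)
  basis-inSpan u = 1 , (λ _ → basis u) , (λ _ → minCutSet s ∘ toℕ , minCutSet-isMinCut s , λ _ → refl) ,
                   (λ _ → 1ℚ) , λ e → sym (trans (ℚP.+-identityʳ _) (ℚP.*-identityˡ _))
    where s = splitAt (suc k) u

  sameCut-xor : ∀ x {y} → SameCut x y → ∀ {u v} → u < n → v < n → x u xor x v ≡ y u xor y v
  sameCut-xor x same {u} {v} u<n v<n =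
    trans (sym (xor-trans (x u) (x 0) (x v))) (cong₂ _xor_ (trans (xor-comm (x u) (x 0)) (same u u<n)) (same v v<n))

  minCutVector-spanned : ∀ v → MinCutVector graph v → SpannedBy graph basis v
  minCutVector-spanned v (X , X-min , v≡χX) with isMinCut⇒minCutSet X X-min
  ... | s , same = δ , λ e → begin
    v e                     ≡⟨ v≡χX e ⟩
    χ graph X e             ≡⟨ χX≡cutVector e ⟩
    cutVector s e           ≡⟨ cong (λ s′ → cutVector s′ e) (splitAt-join (suc k) k s) ⟨
    basis u e               ≡⟨ ℚΣ.∑-δ (λ u′ → basis u′ e) u ⟨
    ℚΣ.sum (λ u′ → δ u′ ℚ.* basis u′ e)
                            ≡⟨ sumFin≡sum (suc k + k) (λ u′ → δ u′ ℚ.* basis u′ e) ⟨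
    linComb {G = graph} δ basis e ∎
    where
    open ≡-Reasoning
    u = join (suc k) k s
    δ : Fin (suc k + k) → ℚ
    δ u′ = ℚΣ.ind (toℕ u ≡ᵇ toℕ u′)
    χX≡cutVector : ∀ e → χ graph X e ≡ cutVector s e
    χX≡cutVector ((i , j) , _) = cong ℚΣ.ind (trans (cong₂ _xor_ (extend-toℕ X i) (extend-toℕ X j))
                                                    (sameCut-xor (extend X) same (toℕ<n i) (toℕ<n j)))

  edgeAt : ∀ {u v} → u < v → v < n → 1 ≤ weight u v → Edge graph
  edgeAt {u} {v} u<v v<n pos = (fromℕ< u<n , fromℕ< v<n) ,
    subst₂ _<_ (sym (toℕ-fromℕ< u<n)) (sym (toℕ-fromℕ< v<n)) u<v ,
    subst (0ℚ ℚ.<_) (cong₂ (λ a b → toℚ (weight a b)) (sym (toℕ-fromℕ< u<n)) (sym (toℕ-fromℕ< v<n)))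
                    (0<toℚ pos)
    where u<n = ℕP.<-trans u<v v<n

  χ-edgeAt : ∀ x {u v} (u<v : u < v) (v<n : v < n) pos →
             χ graph (x ∘ toℕ) (edgeAt u<v v<n pos) ≡ ℚΣ.ind (x u xor x v)
  χ-edgeAt x u<v v<n _ =
    cong₂ (λ a b → ℚΣ.ind (x a xor x b)) (toℕ-fromℕ< (ℕP.<-trans u<v v<n)) (toℕ-fromℕ< v<n)

  module Independence (γ : Fin (suc k + k) → ℚ)
                      (γ-kills : ∀ e → linComb {G = graph} γ basis e ≡ 0ℚ) where

    p : Fin (suc k) → ℚ
    p t = γ (t ↑ˡ k)

    q : Fin k → ℚ
    q j = γ (suc k ↑ʳ j)

    aboveCuts : ℕ → ℕ → Fin (suc k) → ℚ
    aboveCuts u v t = ℚΣ.ind (above (toℕ t) u xor above (toℕ t) v)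

    onlyCuts : ℕ → ℕ → Fin k → ℚ
    onlyCuts u v j = ℚΣ.ind (only (toℕ j) u xor only (toℕ j) v)

    P Q : ℕ → ℕ → ℚ
    P u v = ℚΣ.sum λ t → p t ℚ.* aboveCuts u v t
    Q u v = ℚΣ.sum λ j → q j ℚ.* onlyCuts u v j

    P+Q≡0 : ∀ {u v} → u < v → v < n → 1 ≤ weight u v → P u v ℚ.+ Q u v ≡ 0ℚ
    P+Q≡0 {u} {v} u<v v<n pos = begin
      P u v ℚ.+ Q u v
        ≡⟨ cong₂ ℚ._+_ (ℚΣ.sum-cong-≗ {suc k} λ t → cong (p t ℚ.*_)
                          (trans (sym (χ-edgeAt (above (toℕ t)) u<v v<n pos))
                                 (cong (λ s → cutVector s e) (sym (splitAt-↑ˡ (suc k) t k)))))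
                       (ℚΣ.sum-cong-≗ {k} λ j → cong (q j ℚ.*_)
                          (trans (sym (χ-edgeAt (only (toℕ j)) u<v v<n pos))
                                 (cong (λ s → cutVector s e) (sym (splitAt-↑ʳ (suc k) k j))))) ⟩
      ℚΣ.sum (λ t → γ (t ↑ˡ k) ℚ.* basis (t ↑ˡ k) e)
        ℚ.+ ℚΣ.sum (λ j → γ (suc k ↑ʳ j) ℚ.* basis (suc k ↑ʳ j) e)
        ≡⟨ ℚΣ.∑-↑ˡ-↑ʳ (suc k) (λ u′ → γ u′ ℚ.* basis u′ e) ⟨
      ℚΣ.sum (λ u′ → γ u′ ℚ.* basis u′ e)
        ≡⟨ sumFin≡sum (suc k + k) (λ u′ → γ u′ ℚ.* basis u′ e) ⟨
      linComb {G = graph} γ basis e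
        ≡⟨ γ-kills e ⟩
      0ℚ ∎
      where
      open ≡-Reasoning
      e = edgeAt u<v v<n pos

    ∑p : ℚ
    ∑p = ℚΣ.sum p

    P-ends : P 0 L ≡ ∑p
    P-ends = ℚΣ.sum-cong-≗ {suc k} λ t →
      trans (cong (λ b → p t ℚ.* ℚΣ.ind b) (proj₁ (<⇒<ᵇ-true-false (toℕ<n t)))) (ℚP.*-identityʳ (p t))

    Q-ends : Q 0 L ≡ 0ℚ
    Q-ends = ℚΣ.∑-zero _ λ j →
      trans (cong (λ b → q j ℚ.* ℚΣ.ind b) (<⇒≡ᵇ-false (toℕ<n j))) (ℚP.*-zeroʳ (q j))

    P-split : ∀ v → P 0 v ℚ.+ P v L ≡ ∑p
    P-split v = trans (sym (ℚΣ.∑-distrib-+ {suc k} (λ t → p t ℚ.* aboveCuts 0 v t) (λ t → p t ℚ.* aboveCuts v L t)))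
                      (ℚΣ.sum-cong-≗ {suc k} λ t → begin
      p t ℚ.* aboveCuts 0 v t ℚ.+ p t ℚ.* aboveCuts v L t
        ≡⟨ ℚP.*-distribˡ-+ (p t) (aboveCuts 0 v t) (aboveCuts v L t) ⟨
      p t ℚ.* (aboveCuts 0 v t ℚ.+ aboveCuts v L t)
        ≡⟨ cong (p t ℚ.*_) (ℚΣ.ind-xor-split false (toℕ t <ᵇ suc k) (above (toℕ t) v)
                                             (proj₁ (<⇒<ᵇ-true-false (toℕ<n t)))) ⟩
      p t ℚ.* 1ℚ
        ≡⟨ ℚP.*-identityʳ (p t) ⟩
      p t ∎)
      where open ≡-Reasoning

    Q-fan₀ : ∀ a → Q 0 (suc (toℕ a)) ≡ q a
    Q-fan₀ a = trans (ℚΣ.sum-cong-≗ {k} λ j → ℚP.*-comm (q j) _) (ℚΣ.∑-δ q a)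

    Q-fanL : ∀ a → Q (suc (toℕ a)) L ≡ q a
    Q-fanL a = trans (ℚΣ.sum-cong-≗ {k} λ j → cong (λ b → q j ℚ.* ℚΣ.ind b)
                       (trans (cong ((toℕ a ≡ᵇ toℕ j) xor_) (<⇒≡ᵇ-false (toℕ<n j))) (xor-identityʳ _)))
                     (Q-fan₀ a)

    ∑p≡0 : ∑p ≡ 0ℚ
    ∑p≡0 = begin
      ∑p                ≡⟨ ℚP.+-identityʳ ∑p ⟨
      ∑p ℚ.+ 0ℚ         ≡⟨ cong₂ ℚ._+_ P-ends Q-ends ⟨
      P 0 L ℚ.+ Q 0 L   ≡⟨ P+Q≡0 (s≤s z≤n) ℕP.≤-refl weight-ends ⟩
      0ℚ                ∎
      where open ≡-Reasoning

    q≡0 : ∀ a → q a ≡ 0ℚ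
    q≡0 a = half-zero (q a) (begin
      q a ℚ.+ q a
        ≡⟨ ℚP.+-identityˡ _ ⟨
      0ℚ ℚ.+ (q a ℚ.+ q a)
        ≡⟨ cong (ℚ._+ (q a ℚ.+ q a)) (trans (sym ∑p≡0) (sym (P-split v))) ⟩
      (P 0 v ℚ.+ P v L) ℚ.+ (q a ℚ.+ q a)
        ≡⟨ ℚ+-interchange (P 0 v) (q a) (P v L) (q a) ⟨
      (P 0 v ℚ.+ q a) ℚ.+ (P v L ℚ.+ q a)
        ≡⟨ cong₂ ℚ._+_ (trans (cong (P 0 v ℚ.+_) (sym (Q-fan₀ a)))
                              (P+Q≡0 (s≤s z≤n) v<n (weight-fan₀ (toℕ<n a))))
                       (trans (cong (P v L ℚ.+_) (sym (Q-fanL a)))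
                              (P+Q≡0 (s≤s (toℕ<n a)) ℕP.≤-refl (weight-fanL (toℕ<n a)))) ⟩
      0ℚ ℚ.+ 0ℚ
        ≡⟨ ℚP.+-identityˡ 0ℚ ⟩
      0ℚ ∎)
      where
      open ≡-Reasoning
      v = suc (toℕ a)
      v<n : v < n
      v<n = s≤s (ℕP.m<n⇒m<1+n (toℕ<n a))

    P-path : ∀ t → P (toℕ t) (suc (toℕ t)) ≡ p t
    P-path t = trans (ℚΣ.sum-cong-≗ {suc k} λ t′ →
                       trans (cong (λ b → p t′ ℚ.* ℚΣ.ind b)
                                   (trans (above-step (toℕ t′) (toℕ t)) (≡ᵇ-comm (toℕ t′) (toℕ t))))
                             (ℚP.*-comm (p t′) _))
                     (ℚΣ.∑-δ p t)

    Q-path : ∀ a → Q a (suc a) ≡ 0ℚ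
    Q-path a = ℚΣ.∑-zero _ λ j →
      trans (cong (ℚ._* onlyCuts a (suc a) j) (q≡0 j)) (ℚP.*-zeroˡ (onlyCuts a (suc a) j))

    p≡0 : ∀ t → p t ≡ 0ℚ
    p≡0 t = begin
      p t                         ≡⟨ P-path t ⟨
      P a (suc a)                 ≡⟨ ℚP.+-identityʳ _ ⟨
      P a (suc a) ℚ.+ 0ℚ          ≡⟨ cong (P a (suc a) ℚ.+_) (Q-path a) ⟨
      P a (suc a) ℚ.+ Q a (suc a) ≡⟨ P+Q≡0 ℕP.≤-refl (s≤s (toℕ<n t)) (weight-path (toℕ<n t)) ⟩
      0ℚ                          ∎
      where
      open ≡-Reasoning
      a = toℕ t

    γ≡0 : ∀ u → γ u ≡ 0ℚ
    γ≡0 u with splitAt (suc k) u | join-splitAt (suc k) k u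
    ... | inj₁ t | refl = p≡0 t
    ... | inj₂ j | refl = q≡0 j

  basis-independent : LinIndep graph basis
  basis-independent = Independence.γ≡0

  cdim : CDim graph (suc k + k)
  cdim = basis , basis-inSpan , basis-independent , minCutVector-spanned

theorem1p2 : (n : ℕ) → 2 ≤ n → Σ (WeightedGraph n) λ G → CDim G (2 * n ∸ 3)
theorem1p2 (suc zero)    (s≤s ())
theorem1p2 (suc (suc k)) _ = graph , subst (CDim graph) (cong (_∸ 3) (dimension k)) cdim
  where
  open CutVectors k
  dimension : ∀ k → 3 + (suc k + k) ≡ 2 * suc (suc k)
  dimension = solve-∀
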